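{- Let $f\in F(n)$ and let $X\subseteq\{0,1\}^n$ be a non-empty down set with $f(\bar X)\neq\bar X$, where $\bar X=\{0,1\}^n\setminus X$. Suppose that for every integer $1<\ell<n$, $\bar X$ contains at least $\binom{n-1}{\ell-1}+1$ configurations of weight $\ell$. Then there exists a robustly $X$-converging function $h\in F(n)$ with $h\sim_X f$.
   Context: $F(n)$ is the set of all functions $\{0,1\}^n\to\{0,1\}^n$, written $h=(h_1,\dots,h_n)$. $e_i$ is the configuration with a $1$ exactly in component $i$; addition is componentwise mod $2$. $\mathcal{A}(h)$ is the digraph on $\{0,1\}^n$ with an arc $x\to x+e_i$ whenever $h_i(x)\neq x_i$. $\leq$ is the componentwise order; the weight $w(x)$ is the number of $1$s in $x$. $X$ is a down set if $x\in X$ and $y\leq x$ imply $y\in X$. An arc $x\to y$ of $\mathcal{A}(h)$ is decreasing if $y<x$; a path is decreasing if all its arcs are decreasing. $\mathrm{FP}(h)$ is the set of fixed points of $h$. $h$ is $X$-converging if $\mathcal{A}(h)$ has a decreasing path (possibly of length $0$) from every configuration to $X\cup\mathrm{FP}(h)$. $h$ is robustly $X$-converging if $\pi\circ h\circ\pi^{ -1}$ is $X$-converging for every permutation $\pi$ of $\{0,1\}^n$ acting as the identity on $\bar X$. $h\sim f$ means the digraphs $\mathcal{S}(h)$, $\mathcal{S}(f)$ (arcs $x\to h(x)$, resp. $x\to f(x)$) are isomorphic; $h\sim_X f$ means $h\sim f$ and, for every $x\in X$, $h(x)=f(x)$ if $f(x)\in X$ and $h(x)\notin X$ otherwise. -}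

module Defs where

open import Data.Bool using (Bool; true; false; not; _xor_; _∧_; if_then_else_)
open import Data.Nat using (ℕ; zero; suc; _≡ᵇ_)
open import Data.Fin using (Fin; _≟_)
open import Data.Vec using (Vec; []; _∷_; lookup; tabulate; zipWith)
open import Data.List using (List; []; _∷_; map; _++_; length; filterᵇ)
open import Data.Product using (Σ; ∃; _×_; _,_)
open import Data.Sum using (_⊎_)
open import Relation.Nullary using (¬_; does)
open import Relation.Binary.PropositionalEquality using (_≡_; _≢_)
open import Relation.Binary.Construct.Closure.ReflexiveTransitive using (Star)
open import Function.Bundles using (_↔_; Inverse)

-- configurations {0,1}^n (true = 1)
Config : ℕ → Set
Config n = Vec Bool n

F : ℕ → Set
F n = Config n → Config n

Subset : ℕ → Set
Subset n = Config n → Bool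

_∈_ : ∀ {n} → Config n → Subset n → Set
x ∈ X = X x ≡ true

_∉_ : ∀ {n} → Config n → Subset n → Set
x ∉ X = ¬ (x ∈ X)

e : ∀ {n} → Fin n → Config n
e i = tabulate (λ j → does (i ≟ j))

_⊕_ : ∀ {n} → Config n → Config n → Config n
_⊕_ = zipWith _xor_

data _≤B_ : Bool → Bool → Set where
  f≤b : ∀ {b} → false ≤B b
  t≤t : true ≤B true

_≤c_ : ∀ {n} → Config n → Config n → Set
x ≤c y = ∀ i → lookup x i ≤B lookup y i

_<c_ : ∀ {n} → Config n → Config n → Set
x <c y = x ≤c y × x ≢ y

w : ∀ {n} → Config n → ℕ
w [] = 0
w (true ∷ x) = suc (w x)
w (false ∷ x) = w x

allConfigs : (n : ℕ) → List (Config n)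
allConfigs zero = [] ∷ []
allConfigs (suc n) = map (false ∷_) (allConfigs n) ++ map (true ∷_) (allConfigs n)

countComplWeight : ∀ {n} → Subset n → ℕ → ℕ
countComplWeight {n} X ℓ =
  length (filterᵇ (λ x → not (X x) ∧ (w x ≡ᵇ ℓ)) (allConfigs n))

DownSet : ∀ {n} → Subset n → Set
DownSet X = ∀ x y → x ∈ X → y ≤c x → y ∈ X

NonEmpty : ∀ {n} → Subset n → Set
NonEmpty {n} X = Σ (Config n) λ x → x ∈ X

ImageComplEq : ∀ {n} → F n → Subset n → Set
ImageComplEq {n} f X =
  (∀ x → x ∉ X → f x ∉ X)
  × (∀ y → y ∉ X → Σ (Config n) λ x → x ∉ X × f x ≡ y)

Arc : ∀ {n} → F n → Config n → Config n → Set
Arc {n} h x y = Σ (Fin n) λ i → lookup (h x) i ≢ lookup x i × y ≡ x ⊕ e i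

DecArc : ∀ {n} → F n → Config n → Config n → Set
DecArc h x y = Arc h x y × y <c x

DecPath : ∀ {n} → F n → Config n → Config n → Set
DecPath h = Star (DecArc h)

FixedPoint : ∀ {n} → F n → Config n → Set
FixedPoint h x = h x ≡ x

Converging : ∀ {n} → Subset n → F n → Set
Converging {n} X h =
  ∀ x → Σ (Config n) λ y → DecPath h x y × (y ∈ X ⊎ FixedPoint h y)

Perm : ℕ → Set
Perm n = Config n ↔ Config n

RobustlyConverging : ∀ {n} → Subset n → F n → Set
RobustlyConverging {n} X h =
  (π : Perm n) → (∀ x → x ∉ X → Inverse.to π x ≡ x) →
  Converging X (λ x → Inverse.to π (h (Inverse.from π x)))

-- h ∼ f : the functional digraphs S(h), S(f) are isomorphic,
-- i.e. a vertex bijection π with  x → h x  an arc iff  π x → π (h x) is an arc of S(f)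
Similar : ∀ {n} → F n → F n → Set
Similar {n} h f = Σ (Perm n) λ π → ∀ x → f (Inverse.to π x) ≡ Inverse.to π (h x)

SimilarX : ∀ {n} → Subset n → F n → F n → Set
SimilarX X h f =
  Similar h f ×
  (∀ x → x ∈ X → (f x ∈ X → h x ≡ f x) × (f x ∉ X → h x ∉ X))

{-# OPTIONS --safe #-}

-- Call h non-ascending if every x ∉ X is fixed by h or has a bit that h x clears. Clearing such a
-- bit is a decreasing arc of A(h), so by induction on the weight a non-ascending h is X-converging;
-- conjugating h by a permutation that fixes the complement of X pointwise keeps it non-ascending,
-- because X is a down set. It therefore suffices to conjugate f, by a permutation fixing X
-- pointwise, into a non-ascending function, i.e. to relabel the configurations outside X so that
-- no arc u → f u between them ends at a label strictly above the label of u.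
--
-- Since f(X̄) ≠ X̄, some v₀ ∉ X has no preimage outside X; it gets the label 1ⁿ. The other labels
-- are handed out by increasing weight, each to a vertex whose arc is already harmless. When no
-- such vertex is left, the remaining vertices contain a cycle, which is cut at the lightest label;
-- the successor of the cut vertex later receives a label of minimal weight that clears one of its
-- bits. If that weight ℓ starts a new level then 1 < ℓ < n, and such a label exists because X̄
-- has more than C(n-1, ℓ-1) configurations of weight ℓ, the number of those with a given bit set.

module Submission where

open import Defs
open import Data.Bool using (Bool; true; false; not; _xor_; _∧_; T)
import Data.Bool.Properties as Bool
open import Data.Empty using (⊥; ⊥-elim)
open import Data.Fin using (Fin; zero; suc)
import Data.Fin.Properties as Fin
open import Data.List using (List; []; _∷_; _++_; map; length; filter; filterᵇ)
open import Data.List.Extrema.Nat using (argmin; argmin-sel; f[argmin]≤f[⊤]; f[argmin]≤f[xs])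
open import Data.List.Membership.Propositional using (find; lose) renaming (_∈_ to _∈ˡ_; _∉_ to _∉ˡ_)
open import Data.List.Membership.Propositional.Properties using (∈-filter⁺; ∈-filter⁻; ∈-map⁺; ∈-map⁻; ∈-++⁺ˡ; ∈-++⁺ʳ)
import Data.List.Membership.DecPropositional as DecMembership
open import Data.List.Properties using (length-map; filter-notAll; filter-++; length-++)
open import Data.List.Relation.Binary.Sublist.Propositional using (⊆-refl)
open import Data.List.Relation.Binary.Sublist.Propositional.Properties using (filter⁺; length-mono-≤)
import Data.List.Relation.Unary.All as All
open import Data.List.Relation.Unary.All.Properties using (¬Any⇒All¬)
open import Data.List.Relation.Unary.AllPairs using ([]; _∷_)
open import Data.List.Relation.Unary.Any using (here; there; any?)
import Data.List.Relation.Unary.Any as Any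
open import Data.List.Relation.Unary.Unique.Propositional using (Unique)
import Data.List.Relation.Unary.Unique.Propositional.Properties as Unique
open import Data.Maybe using (Maybe; just; nothing)
open import Data.Nat using (ℕ; zero; suc; _+_; _∸_; _≤_; _<_; _≡ᵇ_; z≤n; s≤s; s≤s⁻¹)
import Data.Nat as ℕ
open import Data.Nat.Combinatorics using (_C_; nCk+nC[k+1]≡[n+1]C[k+1])
open import Data.Nat.GeneralisedArithmetic using (iterate)
open import Data.Nat.Properties using (≤-refl; ≤-reflexive; ≤-trans; <-≤-trans; ≤-<-trans; ≤∧≢⇒<; n≮n; <⇒≱; m≤n⇒m≤1+n; +-identityʳ; +-suc; +-comm; ≡ᵇ⇒≡)
open import Data.Product using (Σ; ∃; _×_; _,_; proj₁; proj₂)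
open import Data.Sum using (_⊎_; inj₁; inj₂; [_,_]′)
open import Data.Unit using (⊤; tt)
open import Data.Vec using ([]; _∷_; lookup; replicate)
open import Data.Vec.Properties using (≡-dec; ∷-injectiveʳ; lookup-zipWith; lookup∘tabulate; lookup-replicate)
open import Function.Base using (_∘_)
open import Function.Bundles using (Inverse; _↔_; mk↔ₛ′)
open import Function.Construct.Composition using (_↔-∘_)
open import Function.Construct.Identity using (↔-id)
open import Function.Construct.Symmetry using (↔-sym)
open import Relation.Binary.Construct.Closure.ReflexiveTransitive using (ε; _◅_)
open import Relation.Binary.Definitions using (DecidableEquality)
open import Relation.Binary.PropositionalEquality using (_≡_; _≢_; ≢-sym; refl; sym; trans; cong; cong₂; subst; module ≡-Reasoning)
open import Relation.Nullary using (¬_; ¬?; Dec; yes; no; contradiction)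
open import Relation.Nullary.Decidable using (map′; _×-dec_; _⊎-dec_; decidable-stable; dec-true; dec-false)
open import Relation.Unary using (Decidable)

_≟ᶜ_ : ∀ {n} → DecidableEquality (Config n)
_≟ᶜ_ = ≡-dec Bool._≟_

_∈?_ : ∀ {n} (x : Config n) (X : Subset n) → Dec (x ∈ X)
x ∈? X = X x Bool.≟ true

_∉?_ : ∀ {n} (x : Config n) (X : Subset n) → Dec (x ∉ X)
x ∉? X = ¬? (x ∈? X)

ones : ∀ n → Config n
ones n = replicate n true

zeros : ∀ n → Config n
zeros n = replicate n false

_⋠_ : ∀ {n} → Config n → Config n → Set
_⋠_ {n} x z = Σ (Fin n) λ i → lookup x i ≡ true × lookup z i ≡ false

_⊀_ : ∀ {n} → Config n → Config n → Set
x ⊀ z = z ≡ x ⊎ x ⋠ z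

⋠⊎≤c : ∀ {n} (x z : Config n) → x ⋠ z ⊎ x ≤c z
⋠⊎≤c [] [] = inj₂ λ ()
⋠⊎≤c (a ∷ x) (b ∷ z) with ⋠⊎≤c x z
... | inj₁ (i , xᵢ , zᵢ) = inj₁ (suc i , xᵢ , zᵢ)
⋠⊎≤c (true ∷ x) (false ∷ z) | inj₂ _ = inj₁ (zero , refl , refl)
⋠⊎≤c (true ∷ x) (true ∷ z) | inj₂ x≤z = inj₂ λ { zero → t≤t ; (suc i) → x≤z i }
⋠⊎≤c (false ∷ x) (b ∷ z) | inj₂ x≤z = inj₂ λ { zero → f≤b ; (suc i) → x≤z i }

≤c-tail : ∀ {n a b} {x z : Config n} → (a ∷ x) ≤c (b ∷ z) → x ≤c z
≤c-tail a∷x≤b∷z i = a∷x≤b∷z (suc i)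

≤c⇒w≤ : ∀ {n} (x z : Config n) → x ≤c z → w x ≤ w z
≤c⇒w≤ [] [] _ = z≤n
≤c⇒w≤ (a ∷ x) (b ∷ z) x≤z with x≤z zero | ≤c⇒w≤ x z (≤c-tail x≤z)
... | f≤b {false} | wx≤wz = wx≤wz
... | f≤b {true} | wx≤wz = m≤n⇒m≤1+n wx≤wz
... | t≤t | wx≤wz = s≤s wx≤wz

≤c⇒w< : ∀ {n} (x z : Config n) (i : Fin n) → x ≤c z → lookup x i ≡ false → lookup z i ≡ true → w x < w z
≤c⇒w< (false ∷ x) (true ∷ z) zero x≤z refl refl = s≤s (≤c⇒w≤ x z (≤c-tail x≤z))
≤c⇒w< (a ∷ x) (b ∷ z) (suc i) x≤z xᵢ zᵢ with x≤z zero | ≤c⇒w< x z i (≤c-tail x≤z) xᵢ zᵢ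
... | f≤b {false} | wx<wz = wx<wz
... | f≤b {true} | wx<wz = m≤n⇒m≤1+n wx<wz
... | t≤t | wx<wz = s≤s wx<wz

≤c∧w≤⇒≡ : ∀ {n} (x z : Config n) → x ≤c z → w z ≤ w x → x ≡ z
≤c∧w≤⇒≡ [] [] _ _ = refl
≤c∧w≤⇒≡ (a ∷ x) (b ∷ z) x≤z wz≤wx with x≤z zero
... | f≤b {false} = cong (false ∷_) (≤c∧w≤⇒≡ x z (≤c-tail x≤z) wz≤wx)
... | t≤t = cong (true ∷_) (≤c∧w≤⇒≡ x z (≤c-tail x≤z) (s≤s⁻¹ wz≤wx))
... | f≤b {true} = contradiction wz≤wx (<⇒≱ (s≤s (≤c⇒w≤ x z (≤c-tail x≤z))))

≤c-antisym : ∀ {n} {x z : Config n} → x ≤c z → z ≤c x → x ≡ z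
≤c-antisym {x = x} {z} x≤z z≤x = ≤c∧w≤⇒≡ x z x≤z (≤c⇒w≤ z x z≤x)

w≤∧≢⇒⋠ : ∀ {n} (y z : Config n) → w z ≤ w y → z ≢ y → y ⋠ z
w≤∧≢⇒⋠ y z wz≤wy z≢y with ⋠⊎≤c y z
... | inj₁ y⋠z = y⋠z
... | inj₂ y≤z = contradiction (sym (≤c∧w≤⇒≡ y z y≤z wz≤wy)) z≢y

≤c-ones : ∀ {n} (x : Config n) → x ≤c ones n
≤c-ones (false ∷ x) zero = f≤b
≤c-ones (true ∷ x) zero = t≤t
≤c-ones (_ ∷ x) (suc i) = ≤c-ones x i

zeros-≤c : ∀ {n} (x : Config n) → zeros n ≤c x
zeros-≤c (_ ∷ x) zero = f≤b
zeros-≤c (_ ∷ x) (suc i) = zeros-≤c x i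

w-ones : ∀ n → w (ones n) ≡ n
w-ones zero = refl
w-ones (suc n) = cong suc (w-ones n)

ones-⊀ : ∀ {n} (z : Config n) → ones n ⊀ z
ones-⊀ {n} z with ⋠⊎≤c (ones n) z
... | inj₁ ones⋠z = inj₂ ones⋠z
... | inj₂ ones≤z = inj₁ (sym (≤c-antisym ones≤z (≤c-ones z)))

w<n : ∀ {n} (z : Config n) → z ≢ ones n → w z < n
w<n {n} z z≢ones with ones-⊀ z
... | inj₁ z≡ones = contradiction z≡ones z≢ones
... | inj₂ (i , _ , zᵢ≡0) =
  subst (w z <_) (w-ones n) (≤c⇒w< z (ones n) i (≤c-ones z) zᵢ≡0 (lookup-replicate i true))

bit⇒0<w : ∀ {n} (z : Config n) (i : Fin n) → lookup z i ≡ true → 0 < w z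
bit⇒0<w (true ∷ z) _ _ = s≤s z≤n
bit⇒0<w (false ∷ z) (suc i) zᵢ = bit⇒0<w z i zᵢ

⊕e-clears : ∀ {n} (x : Config n) (i : Fin n) → lookup x i ≡ true → lookup (x ⊕ e i) i ≡ false
⊕e-clears x i xᵢ = begin
  lookup (x ⊕ e i) i            ≡⟨ lookup-zipWith _xor_ i x (e i) ⟩
  lookup x i xor lookup (e i) i ≡⟨ cong₂ _xor_ xᵢ (trans (lookup∘tabulate _ i) (dec-true (i Fin.≟ i) refl)) ⟩
  true xor true                 ∎
  where open ≡-Reasoning

⊕e-keeps : ∀ {n} (x : Config n) {i j : Fin n} → i ≢ j → lookup (x ⊕ e i) j ≡ lookup x j
⊕e-keeps x {i} {j} i≢j = begin
  lookup (x ⊕ e i) j            ≡⟨ lookup-zipWith _xor_ j x (e i) ⟩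
  lookup x j xor lookup (e i) j ≡⟨ cong (lookup x j xor_) (trans (lookup∘tabulate _ j) (dec-false (i Fin.≟ j) i≢j)) ⟩
  lookup x j xor false          ≡⟨ Bool.xor-identityʳ (lookup x j) ⟩
  lookup x j                    ∎
  where open ≡-Reasoning

≤B-refl : ∀ b → b ≤B b
≤B-refl false = f≤b
≤B-refl true = t≤t

⊕e-≤c : ∀ {n} (x : Config n) (i : Fin n) → lookup x i ≡ true → (x ⊕ e i) ≤c x
⊕e-≤c x i xᵢ j with i Fin.≟ j
... | yes refl = subst (_≤B lookup x i) (sym (⊕e-clears x i xᵢ)) f≤b
... | no i≢j = subst (_≤B lookup x j) (sym (⊕e-keeps x i≢j)) (≤B-refl (lookup x j))

downSet-⋠ : ∀ {n} {X : Subset n} → DownSet X → ∀ {x z} → x ∉ X → z ∈ X → x ⋠ z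
downSet-⋠ downX {x} {z} x∉X z∈X with ⋠⊎≤c x z
... | inj₁ x⋠z = x⋠z
... | inj₂ x≤z = contradiction (downX z x z∈X x≤z) x∉X

-- Non-ascending functions converge robustly

NonAscending : ∀ {n} → Subset n → F n → Set
NonAscending X h = ∀ x → x ∉ X → x ⊀ h x

clearing-arc : ∀ {n} (h : F n) (x : Config n) (i : Fin n) →
               lookup x i ≡ true → lookup (h x) i ≡ false → DecArc h x (x ⊕ e i)
clearing-arc h x i xᵢ hxᵢ =
  (i , (λ hxᵢ≡xᵢ → contradiction (trans (sym hxᵢ) (trans hxᵢ≡xᵢ xᵢ)) λ ()) , refl) ,
  ⊕e-≤c x i xᵢ ,
  λ x⊕eᵢ≡x → contradiction (trans (sym (⊕e-clears x i xᵢ)) (trans (cong (λ v → lookup v i) x⊕eᵢ≡x) xᵢ)) λ ()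

module _ {n} (X : Subset n) {h : F n} (nonAsc : NonAscending X h) where

  descend : ∀ k x → w x < k → Σ (Config n) λ y → DecPath h x y × (y ∈ X ⊎ FixedPoint h y)
  descend (suc k) x (s≤s wx≤k) with x ∈? X
  ... | yes x∈X = x , ε , inj₁ x∈X
  ... | no x∉X with nonAsc x x∉X
  ...   | inj₁ hx≡x = x , ε , inj₂ hx≡x
  ...   | inj₂ (i , xᵢ , hxᵢ) with descend k (x ⊕ e i) (<-≤-trans wx⊕eᵢ<wx wx≤k)
    where wx⊕eᵢ<wx = ≤c⇒w< (x ⊕ e i) x i (⊕e-≤c x i xᵢ) (⊕e-clears x i xᵢ) xᵢ
  ...     | y , path , end = y , clearing-arc h x i xᵢ hxᵢ ◅ path , end

  nonAscending⇒converging : Converging X h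
  nonAscending⇒converging x = descend (suc (w x)) x ≤-refl

module _ {A : Set} (π : A ↔ A) {P : A → Set} (fixes : ∀ x → P x → Inverse.to π x ≡ x) where
  open Inverse π

  from-fixes : ∀ x → P x → from x ≡ x
  from-fixes x px = trans (cong from (sym (fixes x px))) (strictlyInverseʳ x)

  fixed-if-image : ∀ x → P (to x) → to x ≡ x
  fixed-if-image x p = begin
    to x             ≡⟨ strictlyInverseʳ (to x) ⟨
    from (to (to x)) ≡⟨ cong from (fixes (to x) p) ⟩
    from (to x)      ≡⟨ strictlyInverseʳ x ⟩
    x                ∎
    where open ≡-Reasoning

conj : ∀ {n} → Perm n → F n → F n
conj π h x = Inverse.to π (h (Inverse.from π x))

conj-nonAscending : ∀ {n} {X : Subset n} {h : F n} → DownSet X → NonAscending X h →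
                    (π : Perm n) → (∀ x → x ∉ X → Inverse.to π x ≡ x) → NonAscending X (conj π h)
conj-nonAscending {X = X} {h} downX nonAsc π fixes x x∉X
  rewrite from-fixes π fixes x x∉X with Inverse.to π (h x) ∈? X
... | yes πhx∈X = inj₂ (downSet-⋠ downX x∉X πhx∈X)
... | no πhx∉X = subst (x ⊀_) (sym (fixed-if-image π fixes (h x) πhx∉X)) (nonAsc x x∉X)

nonAscending⇒robustlyConverging : ∀ {n} {X : Subset n} {h : F n} → DownSet X → NonAscending X h →
                                   RobustlyConverging X h
nonAscending⇒robustlyConverging {X = X} downX nonAsc π fixes =
  nonAscending⇒converging X (conj-nonAscending downX nonAsc π fixes)

-- Conjugation by permutations fixing X

record ConjugateFixing {n} (X : Subset n) (g h : F n) : Set where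
  constructor conjugateFixing
  field
    perm : Perm n
    fixes : ∀ x → x ∈ X → Inverse.to perm x ≡ x
    conjugates : ∀ x → h x ≡ conj perm g x

conjugateFixing-refl : ∀ {n} {X : Subset n} {g : F n} → ConjugateFixing X g g
conjugateFixing-refl = conjugateFixing (↔-id _) (λ _ _ → refl) λ _ → refl

conjugateFixing-trans : ∀ {n} {X : Subset n} {f g h : F n} →
                        ConjugateFixing X f g → ConjugateFixing X g h → ConjugateFixing X f h
conjugateFixing-trans (conjugateFixing π₁ fix₁ g≡) (conjugateFixing π₂ fix₂ h≡) =
  conjugateFixing (π₂ ↔-∘ π₁) (λ x x∈X → trans (cong (Inverse.to π₂) (fix₁ x x∈X)) (fix₂ x x∈X))
    λ x → trans (h≡ x) (cong (Inverse.to π₂) (g≡ (Inverse.from π₂ x)))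

conjugateFixing⇒similarX : ∀ {n} {X : Subset n} {f h : F n} → ConjugateFixing X f h → SimilarX X h f
conjugateFixing⇒similarX {X = X} {f} {h} (conjugateFixing π fixes h≡) = (↔-sym π , f∘π⁻¹≡π⁻¹∘h) , on-X
  where
  open Inverse π
  f∘π⁻¹≡π⁻¹∘h : ∀ x → f (from x) ≡ from (h x)
  f∘π⁻¹≡π⁻¹∘h x = sym (trans (cong from (h≡ x)) (strictlyInverseʳ (f (from x))))
  h≡πf : ∀ x → x ∈ X → h x ≡ to (f x)
  h≡πf x x∈X = trans (h≡ x) (cong (to ∘ f) (from-fixes π fixes x x∈X))
  on-X : ∀ x → x ∈ X → (f x ∈ X → h x ≡ f x) × (f x ∉ X → h x ∉ X)
  on-X x x∈X = (λ fx∈X → trans (h≡πf x x∈X) (fixes (f x) fx∈X)) , λ fx∉X hx∈X →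
    let πfx∈X = subst (_∈ X) (h≡πf x x∈X) hx∈X
    in fx∉X (subst (_∈ X) (fixed-if-image π fixes (f x) πfx∈X) πfx∈X)

module Transposition {A : Set} (_≟_ : DecidableEquality A) (a b : A) where

  swap : A → A
  swap x with x ≟ a
  ... | yes _ = b
  ... | no _ with x ≟ b
  ...   | yes _ = a
  ...   | no _ = x

  swap-a : swap a ≡ b
  swap-a with a ≟ a
  ... | yes _ = refl
  ... | no a≢a = contradiction refl a≢a

  swap-b : swap b ≡ a
  swap-b with b ≟ a
  ... | yes b≡a = b≡a
  ... | no _ with b ≟ b
  ...   | yes _ = refl
  ...   | no b≢b = contradiction refl b≢b

  swap-other : ∀ {x} → x ≢ a → x ≢ b → swap x ≡ x
  swap-other {x} x≢a x≢b with x ≟ a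
  ... | yes x≡a = contradiction x≡a x≢a
  ... | no _ with x ≟ b
  ...   | yes x≡b = contradiction x≡b x≢b
  ...   | no _ = refl

  swap-involutive : ∀ x → swap (swap x) ≡ x
  swap-involutive x with x ≟ a
  ... | yes refl = swap-b
  ... | no x≢a with x ≟ b
  ...   | yes refl = swap-a
  ...   | no x≢b = swap-other x≢a x≢b

  swap-injective : ∀ {x y} → swap x ≡ swap y → x ≡ y
  swap-injective {x} {y} eq = trans (sym (swap-involutive x)) (trans (cong swap eq) (swap-involutive y))

  swap-closed : (P : A → Set) → P a → P b → ∀ {x} → P x → P (swap x)
  swap-closed P pa pb {x} px with x ≟ a
  ... | yes _ = pb
  ... | no _ with x ≟ b
  ...   | yes _ = pa
  ...   | no _ = px

  swap-outside : (P : A → Set) → P a → P b → ∀ {x} → ¬ P x → swap x ≡ x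
  swap-outside P pa pb ¬px = swap-other (λ { refl → ¬px pa }) (λ { refl → ¬px pb })

  swap-↔ : A ↔ A
  swap-↔ = mk↔ₛ′ swap swap swap-involutive swap-involutive

  iterate-conj : ∀ (g : A → A) k x → iterate (λ y → swap (g (swap y))) x k ≡ swap (iterate g (swap x) k)
  iterate-conj g zero x = sym (swap-involutive x)
  iterate-conj g (suc k) x = trans (iterate-conj g k (swap (g (swap x))))
                                   (cong (λ y → swap (iterate g y k)) (swap-involutive (g (swap x))))

swap-conjugateFixing : ∀ {n} {X : Subset n} (g : F n) {a b : Config n} → a ∉ X → b ∉ X →
                       ConjugateFixing X g (λ x → Transposition.swap _≟ᶜ_ a b (g (Transposition.swap _≟ᶜ_ a b x)))
swap-conjugateFixing {X = X} g a∉X b∉X =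
  conjugateFixing swap-↔ (λ x x∈X → swap-outside (_∉ X) a∉X b∉X (λ x∉X → x∉X x∈X)) λ _ → refl
  where open Transposition _≟ᶜ_ _ _

module DecidableLists {A : Set} (_≟_ : DecidableEquality A) where
  open DecMembership _≟_ using () renaming (_∈?_ to _∈ˡ?_)

  remove : A → List A → List A
  remove b = filter (λ z → ¬? (z ≟ b))

  ∈-remove⁺ : ∀ {b x xs} → x ∈ˡ xs → x ≢ b → x ∈ˡ remove b xs
  ∈-remove⁺ {b} = ∈-filter⁺ (λ z → ¬? (z ≟ b))

  ∈-remove⁻ : ∀ {b x} xs → x ∈ˡ remove b xs → x ∈ˡ xs × x ≢ b
  ∈-remove⁻ {b} xs = ∈-filter⁻ (λ z → ¬? (z ≟ b)) {xs = xs}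

  length-remove< : ∀ {b xs} → b ∈ˡ xs → length (remove b xs) < length xs
  length-remove< {b} {xs} b∈xs = filter-notAll (λ z → ¬? (z ≟ b)) xs (Any.map (λ b≡z z≢b → z≢b (sym b≡z)) b∈xs)

  unique-⊆⇒length≤ : ∀ {xs ys} → Unique xs → (∀ {x} → x ∈ˡ xs → x ∈ˡ ys) → length xs ≤ length ys
  unique-⊆⇒length≤ {[]} _ _ = z≤n
  unique-⊆⇒length≤ {x ∷ xs} (x≢xs ∷ uxs) xs⊆ys =
    ≤-<-trans (unique-⊆⇒length≤ uxs λ z∈xs → ∈-remove⁺ (xs⊆ys (there z∈xs)) (≢-sym (All.lookup x≢xs z∈xs)))
              (length-remove< (xs⊆ys (here refl)))

  module _ (g : A → A) {R : List A} (closed : ∀ {y} → y ∈ˡ R → g y ∈ˡ R) where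

    iterate-suc : ∀ x k → iterate g x (suc k) ≡ g (iterate g x k)
    iterate-suc x zero = refl
    iterate-suc x (suc k) = iterate-suc (g x) k

    PeriodicPoint : Set
    PeriodicPoint = ∃ λ c → c ∈ˡ R × ∃ λ p → iterate g (g c) p ≡ c

    -- The distinct points visited all reach x, and cannot outnumber R: eventually x is revisited.
    walk : ∀ fuel {x} visited → Unique visited → (∀ {v} → v ∈ˡ visited → v ∈ˡ R) → x ∈ˡ R →
           (∀ {v} → v ∈ˡ visited → ∃ λ d → iterate g (g v) d ≡ x) →
           length R < length visited + fuel → PeriodicPoint
    walk zero visited uniq vis⊆R _ _ bound =
      contradiction (unique-⊆⇒length≤ uniq vis⊆R) (<⇒≱ (subst (length R <_) (+-identityʳ _) bound))
    walk (suc fuel) {x} visited uniq vis⊆R x∈R reach bound with x ∈ˡ? visited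
    ... | yes x∈vis = x , x∈R , reach x∈vis
    ... | no x∉vis = walk fuel (x ∷ visited) (¬Any⇒All¬ visited x∉vis ∷ uniq)
                       (λ { (here refl) → x∈R ; (there v∈vis) → vis⊆R v∈vis }) (closed x∈R) reach′
                       (subst (length R <_) (+-suc _ fuel) bound)
      where
      reach′ : ∀ {v} → v ∈ˡ x ∷ visited → ∃ λ d → iterate g (g v) d ≡ g x
      reach′ (here refl) = 0 , refl
      reach′ {v} (there v∈vis) with reach v∈vis
      ... | d , eq = suc d , trans (iterate-suc (g v) d) (cong g eq)

    iterate-closed : ∀ p {z} → z ∈ˡ R → iterate g z p ∈ˡ R
    iterate-closed zero z∈R = z∈R
    iterate-closed (suc p) z∈R = iterate-closed p (closed z∈R)

    periodic-point : ∀ {y} → y ∈ˡ R → PeriodicPoint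
    periodic-point y∈R = walk (suc (length R)) [] [] (λ ()) y∈R (λ ()) ≤-refl

∈-allConfigs : ∀ {n} (x : Config n) → x ∈ˡ allConfigs n
∈-allConfigs [] = here refl
∈-allConfigs (false ∷ x) = ∈-++⁺ˡ (∈-map⁺ (false ∷_) (∈-allConfigs x))
∈-allConfigs (true ∷ x) = ∈-++⁺ʳ _ (∈-map⁺ (true ∷_) (∈-allConfigs x))

allConfigs-unique : ∀ n → Unique (allConfigs n)
allConfigs-unique zero = All.[] ∷ []
allConfigs-unique (suc n) =
  Unique.++⁺ (Unique.map⁺ ∷-injectiveʳ (allConfigs-unique n)) (Unique.map⁺ ∷-injectiveʳ (allConfigs-unique n)) disjoint
  where
  disjoint : ∀ {x} → ¬ (x ∈ˡ map (false ∷_) (allConfigs n) × x ∈ˡ map (true ∷_) (allConfigs n))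
  disjoint (x∈₀ , x∈₁) with ∈-map⁻ (false ∷_) x∈₀ | ∈-map⁻ (true ∷_) x∈₁
  ... | _ , _ , refl | _ , _ , ()

anyᶜ? : ∀ {n} {P : Config n → Set} → Decidable P → Dec (∃ P)
anyᶜ? {n} P? = map′ (λ p → let x , _ , px = find p in x , px) (λ (x , px) → lose (∈-allConfigs x) px) (any? P? (allConfigs n))

-- Counting configurations by weight

#configs : ∀ {n} → (Config n → Bool) → ℕ
#configs {n} p = length (filterᵇ p (allConfigs n))

length-filterᵇ-map : ∀ {A B : Set} (p : B → Bool) (f : A → B) xs →
                     length (filterᵇ p (map f xs)) ≡ length (filterᵇ (λ x → p (f x)) xs)
length-filterᵇ-map p f [] = refl
length-filterᵇ-map p f (x ∷ xs) with p (f x)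
... | true = cong suc (length-filterᵇ-map p f xs)
... | false = length-filterᵇ-map p f xs

length-filterᵇ-none : ∀ {A : Set} (p : A → Bool) → (∀ x → p x ≡ false) → ∀ xs → length (filterᵇ p xs) ≡ 0
length-filterᵇ-none p none [] = refl
length-filterᵇ-none p none (x ∷ xs) with p x | none x
... | false | _ = length-filterᵇ-none p none xs

#configs-suc : ∀ m (p : Config (suc m) → Bool) →
               #configs p ≡ #configs (λ c → p (false ∷ c)) + #configs (λ c → p (true ∷ c))
#configs-suc m p = begin
  length (filterᵇ p (map (false ∷_) (allConfigs m) ++ map (true ∷_) (allConfigs m)))
    ≡⟨ cong length (filter-++ _ (map (false ∷_) (allConfigs m)) _) ⟩
  length (filterᵇ p (map (false ∷_) (allConfigs m)) ++ filterᵇ p (map (true ∷_) (allConfigs m)))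
    ≡⟨ length-++ (filterᵇ p (map (false ∷_) (allConfigs m))) ⟩
  length (filterᵇ p (map (false ∷_) (allConfigs m))) + length (filterᵇ p (map (true ∷_) (allConfigs m)))
    ≡⟨ cong₂ _+_ (length-filterᵇ-map p (false ∷_) (allConfigs m)) (length-filterᵇ-map p (true ∷_) (allConfigs m)) ⟩
  #configs (λ c → p (false ∷ c)) + #configs (λ c → p (true ∷ c)) ∎
  where open ≡-Reasoning

pascal : ∀ m k → m C suc k + m C k ≡ suc m C suc k
pascal m k = trans (+-comm (m C suc k) (m C k)) (nCk+nC[k+1]≡[n+1]C[k+1] m k)

#weight : ∀ m k → #configs {m} (λ c → w c ≡ᵇ k) ≡ m C k
#weight zero zero = refl
#weight zero (suc k) = refl
#weight (suc m) zero =
  trans (#configs-suc m (λ c → w c ≡ᵇ 0))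
        (cong₂ _+_ (#weight m zero) (length-filterᵇ-none _ (λ _ → refl) (allConfigs m)))
#weight (suc m) (suc k) = begin
  #configs {suc m} (λ c → w c ≡ᵇ suc k)
    ≡⟨ #configs-suc m (λ c → w c ≡ᵇ suc k) ⟩
  #configs {m} (λ c → w c ≡ᵇ suc k) + #configs {m} (λ c → w c ≡ᵇ k)
    ≡⟨ cong₂ _+_ (#weight m (suc k)) (#weight m k) ⟩
  m C suc k + m C k      ≡⟨ pascal m k ⟩
  suc m C suc k          ∎
  where open ≡-Reasoning

bit∧weight0 : ∀ {m} (j : Fin m) (c : Config m) → (lookup c j ∧ (w c ≡ᵇ 0)) ≡ false
bit∧weight0 j c with lookup c j in cⱼ
... | false = refl
... | true with w c | bit⇒0<w c j cⱼ
...   | suc _ | _ = refl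

#bit-weight : ∀ m (j : Fin (suc m)) k → #configs {suc m} (λ c → lookup c j ∧ (w c ≡ᵇ suc k)) ≡ m C k
#bit-weight m zero k =
  trans (#configs-suc m _) (cong₂ _+_ (length-filterᵇ-none _ (λ _ → refl) (allConfigs m)) (#weight m k))
#bit-weight (suc m) (suc j) zero =
  trans (#configs-suc (suc m) _) (cong₂ _+_ (#bit-weight m j zero) (length-filterᵇ-none _ (bit∧weight0 j) (allConfigs (suc m))))
#bit-weight (suc m) (suc j) (suc k) = begin
  #configs {suc (suc m)} (λ c → lookup c (suc j) ∧ (w c ≡ᵇ suc (suc k)))
    ≡⟨ #configs-suc (suc m) _ ⟩
  #configs {suc m} (λ c → lookup c j ∧ (w c ≡ᵇ suc (suc k))) + #configs {suc m} (λ c → lookup c j ∧ (w c ≡ᵇ suc k))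
    ≡⟨ cong₂ _+_ (#bit-weight m j (suc k)) (#bit-weight m j k) ⟩
  m C suc k + m C k     ≡⟨ pascal m k ⟩
  suc m C suc k         ∎
  where open ≡-Reasoning

-- There are C(n-1, ℓ-1) configurations of weight ℓ with bit i set, so the hypothesis leaves one
-- outside X with bit i clear.
complement-avoids : ∀ {n} (X : Subset n) →
  (∀ ℓ → 1 < ℓ → ℓ < n → suc ((n ∸ 1) C (ℓ ∸ 1)) ≤ countComplWeight X ℓ) →
  ∀ ℓ → 1 < ℓ → ℓ < n → (i : Fin n) → ∃ λ c → c ∉ X × w c ≡ ℓ × lookup c i ≡ false
complement-avoids {suc m} X rich (suc k) 1<ℓ ℓ<n i
  with anyᶜ? (λ c → (c ∉? X) ×-dec (w c ℕ.≟ suc k) ×-dec (lookup c i Bool.≟ false))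
... | yes found = found
... | no none = contradiction (≤-trans (rich (suc k) 1<ℓ ℓ<n) (subst (_ ≤_) (#bit-weight m i k) complement≤bit)) (n≮n _)
  where
  complement-weight bit-weight : Config (suc m) → Bool
  complement-weight c = not (X c) ∧ (w c ≡ᵇ suc k)
  bit-weight c = lookup c i ∧ (w c ≡ᵇ suc k)
  complement⇒bit : ∀ c → T (complement-weight c) → T (bit-weight c)
  complement⇒bit c t with X c in Xc | lookup c i in cᵢ
  ... | false | true = t
  ... | false | false = ⊥-elim (none (c , Bool.not-¬ Xc , ≡ᵇ⇒≡ (w c) (suc k) t , cᵢ))
  complement≤bit : countComplWeight X (suc k) ≤ #configs bit-weight
  complement≤bit = length-mono-≤ (filter⁺ (Bool.T? ∘ complement-weight) (Bool.T? ∘ bit-weight) (λ { refl → complement⇒bit _ }) (⊆-refl {x = allConfigs (suc m)}))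

-- A leaf outside X

module _ {n} (X : Subset n) (f : F n) where

  HasPreimage : Config n → Set
  HasPreimage y = ∃ λ x → x ∉ X × f x ≡ y

  -- Pigeonhole: f maps D, which misses x₀, onto Y.
  covered⇒closed : (∀ y → y ∉ X → HasPreimage y) → ∀ x → x ∉ X → f x ∉ X
  covered⇒closed covered x₀ x₀∉X fx₀∈X = n≮n (length Y) (≤-<-trans Y≤D D<Y)
    where
    open DecidableLists _≟ᶜ_
    Y D : List (Config n)
    Y = filter (_∉? X) (allConfigs n)
    D = filter (λ x → f x ∉? X) Y
    complement-⊆-image : ∀ {y} → y ∉ X → y ∈ˡ map f D
    complement-⊆-image y∉X with covered _ y∉X
    ... | x , x∉X , refl = ∈-map⁺ f (∈-filter⁺ (λ x → f x ∉? X) (∈-filter⁺ (_∉? X) (∈-allConfigs x) x∉X) y∉X)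
    Y⊆fD : ∀ {y} → y ∈ˡ Y → y ∈ˡ map f D
    Y⊆fD y∈Y = complement-⊆-image (proj₂ (∈-filter⁻ (_∉? X) {xs = allConfigs n} y∈Y))
    Y≤D : length Y ≤ length D
    Y≤D = subst (length Y ≤_) (length-map f D) (unique-⊆⇒length≤ (Unique.filter⁺ (_∉? X) (allConfigs-unique n)) Y⊆fD)
    D<Y : length D < length Y
    D<Y = filter-notAll (λ x → f x ∉? X) Y (lose (∈-filter⁺ (_∉? X) (∈-allConfigs x₀) x₀∉X) λ fx₀∉X → fx₀∉X fx₀∈X)

  hasPreimage? : ∀ y → Dec (HasPreimage y)
  hasPreimage? y = anyᶜ? (λ x → (x ∉? X) ×-dec (f x ≟ᶜ y))

  complement-leaf : ¬ ImageComplEq f X → ∃ λ v → v ∉ X × (∀ x → x ∉ X → f x ≢ v)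
  complement-leaf ¬closed with anyᶜ? (λ v → (v ∉? X) ×-dec ¬? (hasPreimage? v))
  ... | yes (v , v∉X , ¬pre) = v , v∉X , λ x x∉X fx≡v → ¬pre (x , x∉X , fx≡v)
  ... | no ¬leaf = contradiction (covered⇒closed covered , covered) ¬closed
    where
    covered : ∀ y → y ∉ X → HasPreimage y
    covered y y∉X = decidable-stable (hasPreimage? y) (λ ¬pre → ¬leaf (y , y∉X , ¬pre))

-- The relabelling

-- The current function g is f conjugated by the transpositions made so far. R lists the labels
-- not yet handed out; they are handed out by increasing weight, and a movable configuration
-- outside R is a vertex already in its final place. The only placed vertex whose arc may still
-- enter R is the pending one: it lies on a cycle of g, and a lightest label of R clearing one of
-- its bits is reserved for its successor. The label 1ⁿ is never moved.
module Relabelling {n} (X : Subset n) (downX : DownSet X) (zeros∈X : zeros n ∈ X)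
  (avoid : ∀ ℓ → 1 < ℓ → ℓ < n → (i : Fin n) → ∃ λ c → c ∉ X × w c ≡ ℓ × lookup c i ≡ false) where

  open DecidableLists (_≟ᶜ_ {n})
  open DecMembership (_≟ᶜ_ {n}) using () renaming (_∈?_ to _∈ˡ?_)

  Movable : Config n → Set
  Movable y = y ∉ X × y ≢ ones n

  Placed : List (Config n) → Config n → Set
  Placed R y = Movable y × y ∉ˡ R

  Lightest : List (Config n) → Config n → Set
  Lightest R c = ∀ {z} → z ∈ˡ R → w c ≤ w z

  Reserved : List (Config n) → Config n → Set
  Reserved R a = ∃ λ c → c ∈ˡ R × Lightest R c × a ⋠ c

  IsPending : Maybe (Config n) → Config n → Set
  IsPending nothing u = ⊥
  IsPending (just a) u = u ≡ a

  PendingSpec : F n → List (Config n) → Maybe (Config n) → Set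
  PendingSpec g R nothing = ⊤
  PendingSpec g R (just a) = Placed R a × g a ∈ˡ R × (∃ λ p → iterate g (g a) p ≡ a) × Reserved R a

  Settled : F n → List (Config n) → Maybe (Config n) → Config n → Set
  Settled g R pd u = (Placed R (g u) → u ⊀ g u) × (g u ∈ˡ R → IsPending pd u)

  record Invariant (g : F n) (R : List (Config n)) (pd : Maybe (Config n)) : Set where
    field
      remaining-movable : ∀ {y} → y ∈ˡ R → Movable y
      placed-lighter : ∀ {y z} → Placed R y → z ∈ˡ R → w y ≤ w z
      ones-preimage : ∀ y → g y ≡ ones n → y ∈ X
      placed-settled : ∀ u → Placed R u → Settled g R pd u
      pending-spec : PendingSpec g R pd

  -- y may take the lightest free label: its arc leaves the complement of X, is a loop, or ends
  -- at a placed vertex, which is no heavier.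
  Ready : F n → List (Config n) → Config n → Set
  Ready g R y = g y ∈ X ⊎ Placed R (g y) ⊎ g y ≡ y

  ready? : ∀ g R y → Dec (Ready g R y)
  ready? g R y = (g y ∈? X) ⊎-dec (((g y ∉? X) ×-dec ¬? (g y ≟ᶜ ones n)) ×-dec ¬? (g y ∈ˡ? R)) ⊎-dec (g y ≟ᶜ y)

  lightest : ∀ {R z} → z ∈ˡ R → ∃ λ c → c ∈ˡ R × Lightest R c
  lightest {r ∷ rs} _ = argmin w r rs , [ here , there ]′ (argmin-sel w r rs) , bound
    where
    bound : Lightest (r ∷ rs) (argmin w r rs)
    bound (here refl) = f[argmin]≤f[⊤] {f = w} r rs
    bound (there z∈rs) = All.lookup (f[argmin]≤f[xs] {f = w} r rs) z∈rs

  module _ {g R pd} (inv : Invariant g R pd) where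
    open Invariant inv

    unready-stays : ∀ {y} → y ∈ˡ R → ¬ Ready g R y → g y ∈ˡ R × g y ≢ y
    unready-stays {y} y∈R ¬ready with g y ∈ˡ? R | g y ∈? X
    ... | yes gy∈R | _ = gy∈R , λ gy≡y → ¬ready (inj₂ (inj₂ gy≡y))
    ... | no _ | yes gy∈X = ⊥-elim (¬ready (inj₁ gy∈X))
    ... | no gy∉R | no gy∉X = ⊥-elim (¬ready (inj₂ (inj₁ ((gy∉X , gy≢ones) , gy∉R))))
      where gy≢ones = λ gy≡ones → proj₁ (remaining-movable y∈R) (ones-preimage y gy≡ones)

  all-placed⇒nonAscending : ∀ {g pd} → Invariant g [] pd → NonAscending X g
  all-placed⇒nonAscending {g} inv x x∉X with x ≟ᶜ ones n | g x ∈? X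
  ... | yes refl | _ = ones-⊀ (g x)
  ... | no _ | yes gx∈X = inj₂ (downSet-⋠ downX x∉X gx∈X)
  ... | no x≢ones | no gx∉X = proj₁ (placed-settled x ((x∉X , x≢ones) , λ ())) ((gx∉X , gx≢ones) , λ ())
    where
    open Invariant inv
    gx≢ones = λ gx≡ones → x∉X (ones-preimage x gx≡ones)

  record Step (g : F n) (R : List (Config n)) : Set where
    field
      g′ : F n
      R′ : List (Config n)
      pd′ : Maybe (Config n)
      conjugate : ConjugateFixing X g g′
      shorter : length R′ < length R
      invariant : Invariant g′ R′ pd′

  module Assign {g R pd} (inv : Invariant g R pd) {b y} (b∈R : b ∈ˡ R) (y∈R : y ∈ˡ R) (b-lightest : Lightest R b) where
    open Invariant inv
    open Transposition _≟ᶜ_ b y public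

    g′ : F n
    g′ x = swap (g (swap x))

    R′ : List (Config n)
    R′ = remove b R

    ∈R′⁻ : ∀ {z} → z ∈ˡ R′ → z ∈ˡ R × z ≢ b
    ∈R′⁻ = ∈-remove⁻ R

    R′⊆R : ∀ {z} → z ∈ˡ R′ → z ∈ˡ R
    R′⊆R = proj₁ ∘ ∈R′⁻

    swap-fixes : ∀ {z} → z ∉ˡ R → swap z ≡ z
    swap-fixes = swap-outside (_∈ˡ R) b∈R y∈R

    swap-stays : ∀ {z} → z ∈ˡ R → swap z ∈ˡ R
    swap-stays = swap-closed (_∈ˡ R) b∈R y∈R

    placed′-cases : ∀ {u} → Placed R′ u → Placed R u ⊎ u ≡ b
    placed′-cases {u} (movable , u∉R′) with u ≟ᶜ b | u ∈ˡ? R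
    ... | yes u≡b | _ = inj₂ u≡b
    ... | no u≢b | yes u∈R = ⊥-elim (u∉R′ (∈-remove⁺ u∈R u≢b))
    ... | no _ | no u∉R = inj₁ (movable , u∉R)

    b-placed′ : Placed R′ b
    b-placed′ = remaining-movable b∈R , λ b∈R′ → proj₂ (∈R′⁻ b∈R′) refl

    swap-∈R′ : ∀ {z} → z ∈ˡ R → z ≢ y → swap z ∈ˡ R′
    swap-∈R′ z∈R z≢y = ∈-remove⁺ (swap-stays z∈R) (λ sz≡b → z≢y (swap-injective (trans sz≡b (sym swap-b))))

    placed⇒placed′ : ∀ {u} → Placed R u → Placed R′ u
    placed⇒placed′ (movable , u∉R) = movable , u∉R ∘ R′⊆R

    placed′-≤b : ∀ {u} → Placed R′ u → w u ≤ w b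
    placed′-≤b placed′ with placed′-cases placed′
    ... | inj₁ placed = placed-lighter placed b∈R
    ... | inj₂ refl = ≤-refl

    g′-placed : ∀ {u} → Placed R u → g′ u ≡ swap (g u)
    g′-placed (_ , u∉R) = cong (swap ∘ g) (swap-fixes u∉R)

    g′-b : g′ b ≡ swap (g y)
    g′-b = cong (swap ∘ g) swap-a

    cycle′ : ∀ {a} p → iterate g (g (swap a)) p ≡ swap a → iterate g′ (g′ a) p ≡ a
    cycle′ {a} p cyc = begin
      iterate g′ (g′ a) p              ≡⟨ iterate-conj g (suc p) a ⟩
      swap (iterate g (g (swap a)) p)  ≡⟨ cong swap cyc ⟩
      swap (swap a)                    ≡⟨ swap-involutive a ⟩
      a                                ∎
      where open ≡-Reasoning

    ones-preimage′ : ∀ u → g′ u ≡ ones n → u ∈ X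
    ones-preimage′ u g′u≡ones = unswap (u ∈ˡ? R)
      where
      ones∉R : ones n ∉ˡ R
      ones∉R ones∈R = proj₂ (remaining-movable ones∈R) refl
      su∈X : swap u ∈ X
      su∈X = ones-preimage (swap u)
        (trans (sym (swap-involutive _)) (trans (cong swap g′u≡ones) (swap-fixes ones∉R)))
      unswap : Dec (u ∈ˡ R) → u ∈ X
      unswap (yes u∈R) = ⊥-elim (proj₁ (remaining-movable (swap-stays u∈R)) su∈X)
      unswap (no u∉R) = subst (_∈ X) (swap-fixes u∉R) su∈X

    settled-via : ∀ {pd′ u v} → g′ u ≡ v → (Placed R′ v → u ⊀ v) → v ∉ˡ R′ → Settled g′ R′ pd′ u
    settled-via refl arc v∉R′ = arc , ⊥-elim ∘ v∉R′

    untouched-settled : ∀ {pd′ u} → Placed R u → g u ∉ˡ R → Settled g′ R′ pd′ u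
    untouched-settled {u = u} placed gu∉R =
      settled-via (trans (g′-placed placed) (swap-fixes gu∉R))
        (λ (movable , _) → proj₁ (placed-settled u placed) (movable , gu∉R)) (gu∉R ∘ R′⊆R)

    ready-settled : ∀ {pd′} → Ready g R y → Settled g′ R′ pd′ b
    ready-settled (inj₁ gy∈X) =
      settled-via (trans g′-b (swap-fixes gy∉R)) (λ placed → ⊥-elim (proj₁ (proj₁ placed) gy∈X)) (gy∉R ∘ R′⊆R)
      where gy∉R = λ gy∈R → proj₁ (remaining-movable gy∈R) gy∈X
    ready-settled (inj₂ (inj₁ gy-placed)) =
      settled-via (trans g′-b (swap-fixes (proj₂ gy-placed)))
        (λ _ → inj₂ (w≤∧≢⇒⋠ b (g y) (placed-lighter gy-placed b∈R) gy≢b)) (proj₂ gy-placed ∘ R′⊆R)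
      where gy≢b = λ gy≡b → proj₂ gy-placed (subst (_∈ˡ R) (sym gy≡b) b∈R)
    ready-settled (inj₂ (inj₂ gy≡y)) =
      settled-via (trans g′-b (trans (cong swap gy≡y) swap-b)) (λ _ → inj₁ refl) (proj₂ b-placed′)

    invariant′ : ∀ pd′ → Settled g′ R′ pd′ b → (∀ u → Placed R u → IsPending pd u → Settled g′ R′ pd′ u) →
                 PendingSpec g′ R′ pd′ → Invariant g′ R′ pd′
    invariant′ pd′ b-settled pending-settled spec = record
      { remaining-movable = remaining-movable ∘ R′⊆R
      ; placed-lighter = λ placed′ z∈R′ → ≤-trans (placed′-≤b placed′) (b-lightest (R′⊆R z∈R′))
      ; ones-preimage = ones-preimage′
      ; placed-settled = settled′
      ; pending-spec = spec
      }
      where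
      settled′ : ∀ u → Placed R′ u → Settled g′ R′ pd′ u
      settled′ u placed′ with placed′-cases placed′
      ... | inj₂ refl = b-settled
      ... | inj₁ placed with g u ∈ˡ? R
      ...   | yes gu∈R = pending-settled u placed (proj₂ (placed-settled u placed) gu∈R)
      ...   | no gu∉R = untouched-settled placed gu∉R

    -- The lightest level of R′ lies above w b, so all of it is still in R′, and the hypothesis
    -- on the complement of X provides a label there that clears a bit of a.
    reserve-new-level : ∀ {a z₀} → a ∉ X → w a ≤ w b → z₀ ∈ˡ R′ → (∀ {z} → z ∈ˡ R′ → w b < w z) → Reserved R′ a
    reserve-new-level {a} a∉X wa≤wb z₀∈R′ heavier with lightest z₀∈R′ | downSet-⋠ downX a∉X zeros∈X
    ... | c₁ , c₁∈R′ , c₁-lightest | i , aᵢ , _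
      with avoid (w c₁) (≤-<-trans (≤-trans (bit⇒0<w a i aᵢ) wa≤wb) (heavier c₁∈R′)) wc₁<n i
      where wc₁<n = w<n c₁ (proj₂ (remaining-movable (R′⊆R c₁∈R′)))
    ... | c , c∉X , wc≡wc₁ , cᵢ = c , c∈R′ , (λ z∈R′ → subst (_≤ _) (sym wc≡wc₁) (c₁-lightest z∈R′)) , (i , aᵢ , cᵢ)
      where
      wc<n : w c < n
      wc<n = subst (_< n) (sym wc≡wc₁) (w<n c₁ (proj₂ (remaining-movable (R′⊆R c₁∈R′))))
      c≢ones : c ≢ ones n
      c≢ones c≡ones = n≮n n (subst (_< n) (trans (cong w c≡ones) (w-ones n)) wc<n)
      c∈R′ : c ∈ˡ R′
      c∈R′ with c ∈ˡ? R′
      ... | yes c∈R′ = c∈R′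
      ... | no c∉R′ = contradiction (placed′-≤b ((c∉X , c≢ones) , c∉R′))
                                    (<⇒≱ (subst (w b <_) (sym wc≡wc₁) (heavier c₁∈R′)))

    reserve : ∀ {a} → a ∉ X → w a ≤ w b → (∃ λ z → z ∈ˡ R′) →
              (∀ {z} → z ∈ˡ R′ → w z ≡ w b → a ⋠ z) → Reserved R′ a
    reserve a∉X wa≤wb (_ , z₀∈R′) same-weight with any? (λ z → w z ℕ.≟ w b) R′
    ... | yes found = let z , z∈R′ , wz≡wb = find found in
      z , z∈R′ , (λ z′∈R′ → subst (_≤ _) (sym wz≡wb) (b-lightest (R′⊆R z′∈R′))) , same-weight z∈R′ wz≡wb
    ... | no none = reserve-new-level a∉X wa≤wb z₀∈R′ λ z∈R′ →
      ≤∧≢⇒< (b-lightest (R′⊆R z∈R′)) (λ wb≡wz → none (lose z∈R′ (sym wb≡wz)))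

    step : ∀ {pd′} → Invariant g′ R′ pd′ → Step g R
    step inv′ = record
      { conjugate = swap-conjugateFixing g (proj₁ (remaining-movable b∈R)) (proj₁ (remaining-movable y∈R))
      ; shorter = length-remove< b∈R
      ; invariant = inv′
      }

  place-ready : ∀ {g R b y} → Invariant g R nothing → b ∈ˡ R → y ∈ˡ R → Lightest R b → Ready g R y → Step g R
  place-ready inv b∈R y∈R b-lightest y-ready = step (invariant′ nothing (ready-settled y-ready) (λ _ _ ()) tt)
    where open Assign inv b∈R y∈R b-lightest

  -- No vertex is ready, so R is closed under g; a periodic vertex c takes the label b and is pending.
  break-cycle : ∀ {g R b} → Invariant g R nothing → b ∈ˡ R → Lightest R b → (∀ {y} → y ∈ˡ R → ¬ Ready g R y) → Step g R
  break-cycle {g} {R} {b} inv b∈R b-lightest unready with periodic-point g (λ y∈R → proj₁ (unready-stays inv y∈R (unready y∈R))) b∈R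
  ... | c , c∈R , p , cyc = step (invariant′ (just b) b-settled (λ _ _ ()) (b-placed′ , gb∈R′ , (p , cycle′ p cyc′) , reservation))
    where
    open Invariant inv
    open Assign inv b∈R c∈R b-lightest
    gb∈R′ : g′ b ∈ˡ R′
    gb∈R′ = subst (_∈ˡ R′) (sym g′-b) (swap-∈R′ (proj₁ gc-stays) (proj₂ gc-stays))
      where gc-stays = unready-stays inv c∈R (unready c∈R)
    b-settled : Settled g′ R′ (just b) b
    b-settled = (λ placed → ⊥-elim (proj₂ placed gb∈R′)) , λ _ → refl
    cyc′ : iterate g (g (swap b)) p ≡ swap b
    cyc′ = subst (λ v → iterate g (g v) p ≡ v) (sym swap-a) cyc
    reservation : Reserved R′ b
    reservation = reserve (proj₁ (remaining-movable b∈R)) ≤-refl (_ , gb∈R′)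
      λ {z} z∈R′ wz≡wb → w≤∧≢⇒⋠ b z (≤-reflexive wz≡wb) (proj₂ (∈R′⁻ z∈R′))

  settle-pending : ∀ {g R a c} → Invariant g R (just a) → Placed R a → g a ∈ˡ R → c ∈ˡ R → Lightest R c → a ⋠ c →
                   Ready g R (g a) → Step g R
  settle-pending {g} {R} {a} inv a-placed ga∈R c∈R c-lightest a⋠c ga-ready =
    step (invariant′ nothing (ready-settled ga-ready) pending-settled tt)
    where
    open Assign inv c∈R ga∈R c-lightest
    pending-settled : ∀ u → Placed R u → IsPending (just a) u → Settled g′ R′ nothing u
    pending-settled u placed refl =
      settled-via (trans (g′-placed placed) swap-b) (λ _ → inj₂ a⋠c) (λ c∈R′ → proj₂ (∈R′⁻ c∈R′) refl)

  -- The successor of the pending vertex a is not ready yet, but some vertex y is; it takes a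
  -- lightest label b, and a stays pending.
  module KeepPending {g R a} (inv : Invariant g R (just a)) (a-placed : Placed R a) (ga∈R : g a ∈ˡ R)
    (p : ℕ) (cyc : iterate g (g a) p ≡ a) (ga-unready : ¬ Ready g R (g a))
    {y} (y∈R : y ∈ˡ R) (y-ready : Ready g R y) {b} (b∈R : b ∈ˡ R) (b-lightest : Lightest R b) where
    open Assign inv b∈R y∈R b-lightest public

    ga′∈R′ : g′ a ∈ˡ R′
    ga′∈R′ = subst (_∈ˡ R′) (sym (g′-placed a-placed)) (swap-∈R′ ga∈R λ ga≡y → ga-unready (subst (Ready g R) (sym ga≡y) y-ready))

    keep : Reserved R′ a → Step g R
    keep reservation = step (invariant′ (just a) (ready-settled y-ready) pending-settled
                              (placed⇒placed′ a-placed , ga′∈R′ , (p , cycle′ p cyc′) , reservation))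
      where
      cyc′ : iterate g (g (swap a)) p ≡ swap a
      cyc′ = subst (λ v → iterate g (g v) p ≡ v) (sym (swap-fixes (proj₂ a-placed))) cyc
      pending-settled : ∀ u → Placed R u → IsPending (just a) u → Settled g′ R′ (just a) u
      pending-settled u _ refl = (λ placed′ → ⊥-elim (proj₂ placed′ ga′∈R′)) , λ _ → refl

  ready-exists : ∀ {g R a} → Invariant g R (just a) → Placed R a → g a ∈ˡ R → ∀ p → iterate g (g a) p ≡ a →
                 ∃ λ y → y ∈ˡ R × Ready g R y
  ready-exists {g} {R} inv a-placed ga∈R p cyc with any? (ready? g R) R
  ... | yes found = find found
  ... | no none = ⊥-elim (proj₂ a-placed (subst (_∈ˡ R) cyc (iterate-closed g closed p ga∈R)))
    where
    closed : ∀ {y} → y ∈ˡ R → g y ∈ˡ R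
    closed y∈R = proj₁ (unready-stays inv y∈R (λ y-ready → none (lose y∈R y-ready)))

  step : ∀ {g r rs pd} → Invariant g (r ∷ rs) pd → Step g (r ∷ rs)
  step {g} {r} {rs} {nothing} inv with lightest (here refl) | any? (ready? g (r ∷ rs)) (r ∷ rs)
  ... | b , b∈R , b-lightest | yes found = let y , y∈R , y-ready = find found in place-ready inv b∈R y∈R b-lightest y-ready
  ... | b , b∈R , b-lightest | no none = break-cycle inv b∈R b-lightest λ y∈R y-ready → none (lose y∈R y-ready)
  step {g} {r} {rs} {just a} inv with Invariant.pending-spec inv
  ... | a-placed , ga∈R , (p , cyc) , c , c∈R , c-lightest , a⋠c with ready? g (r ∷ rs) (g a)
  ...   | yes ga-ready = settle-pending inv a-placed ga∈R c∈R c-lightest a⋠c ga-ready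
  ...   | no ga-unready with ready-exists inv a-placed ga∈R p cyc | any? (λ z → ¬? (z ≟ᶜ c) ×-dec (w z ℕ.≟ w c)) (r ∷ rs)
  ...     | y , y∈R , y-ready | yes found =
    let b , b∈R , b≢c , wb≡wc = find found
        module K = KeepPending inv a-placed ga∈R p cyc ga-unready y∈R y-ready b∈R
                     (λ z∈R → subst (_≤ _) (sym wb≡wc) (c-lightest z∈R))
    in K.keep (c , ∈-remove⁺ c∈R (≢-sym b≢c) , c-lightest ∘ K.R′⊆R , a⋠c)
  ...     | y , y∈R , y-ready | no none =
    let module K = KeepPending inv a-placed ga∈R p cyc ga-unready y∈R y-ready c∈R c-lightest
    in K.keep (K.reserve (proj₁ (proj₁ a-placed)) (Invariant.placed-lighter inv a-placed c∈R) (_ , K.ga′∈R′)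
                 λ z∈R′ wz≡wc → ⊥-elim (none (lose (K.R′⊆R z∈R′) (proj₂ (K.∈R′⁻ z∈R′) , wz≡wc))))

  relabel : ∀ k {g R pd} → length R < k → Invariant g R pd → ∃ λ h → ConjugateFixing X g h × NonAscending X h
  relabel (suc k) {g} {[]} _ inv = g , conjugateFixing-refl , all-placed⇒nonAscending inv
  relabel (suc k) {g} {r ∷ rs} (s≤s |R|≤k) inv with step inv
  ... | next with relabel k (<-≤-trans (Step.shorter next) |R|≤k) (Step.invariant next)
  ...   | h , conjugate , nonAsc = h , conjugateFixing-trans (Step.conjugate next) conjugate , nonAsc

-- Swapping v₀ with 1ⁿ first gives 1ⁿ no preimage outside X.
nonAscending-conjugate : ∀ {n} (X : Subset n) (f : F n) → DownSet X → zeros n ∈ X →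
  (∀ ℓ → 1 < ℓ → ℓ < n → (i : Fin n) → ∃ λ c → c ∉ X × w c ≡ ℓ × lookup c i ≡ false) →
  ∀ {v₀} → v₀ ∉ X → (∀ x → x ∉ X → f x ≢ v₀) →
  ∃ λ h → ConjugateFixing X f h × NonAscending X h
nonAscending-conjugate {n} X f downX zeros∈X avoid {v₀} v₀∉X v₀-leaf =
  let h , conj , nonAsc = relabel (suc (length R₀)) ≤-refl inv₀
  in h , conjugateFixing-trans (swap-conjugateFixing f v₀∉X ones∉X) conj , nonAsc
  where
  ones∉X : ones n ∉ X
  ones∉X ones∈X = v₀∉X (downX (ones n) v₀ ones∈X (≤c-ones v₀))
  open Relabelling X downX zeros∈X avoid
  open Transposition _≟ᶜ_ v₀ (ones n)
  g₀ : F n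
  g₀ x = swap (f (swap x))
  R₀ : List (Config n)
  R₀ = filter (λ y → (y ∉? X) ×-dec ¬? (y ≟ᶜ ones n)) (allConfigs n)
  ¬placed₀ : ∀ {y} → ¬ Placed R₀ y
  ¬placed₀ {y} (movable , y∉R₀) = y∉R₀ (∈-filter⁺ _ (∈-allConfigs y) movable)
  ones-preimage₀ : ∀ y → g₀ y ≡ ones n → y ∈ X
  ones-preimage₀ y g₀y≡ones with swap y ∈? X
  ... | yes sy∈X = subst (_∈ X) (trans (sym (swap-outside (_∉ X) v₀∉X ones∉X (λ sy∉X → sy∉X sy∈X))) (swap-involutive y)) sy∈X
  ... | no sy∉X = ⊥-elim (v₀-leaf (swap y) sy∉X (trans (sym (swap-involutive _)) (trans (cong swap g₀y≡ones) swap-b)))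
  inv₀ : Invariant g₀ R₀ nothing
  inv₀ = record
    { remaining-movable = λ y∈R₀ → proj₂ (∈-filter⁻ _ {xs = allConfigs n} y∈R₀)
    ; placed-lighter = λ placed → ⊥-elim (¬placed₀ placed)
    ; ones-preimage = ones-preimage₀
    ; placed-settled = λ _ placed → ⊥-elim (¬placed₀ placed)
    ; pending-spec = tt
    }

lemma9 : (n : ℕ) (f : F n) (X : Subset n) →
    NonEmpty X → DownSet X → ¬ ImageComplEq f X →
    (∀ ℓ → 1 < ℓ → ℓ < n → suc ((n ∸ 1) C (ℓ ∸ 1)) ≤ countComplWeight X ℓ) →
    Σ (F n) λ h → RobustlyConverging X h × SimilarX X h f
lemma9 n f X (x₀ , x₀∈X) downX ¬closed rich =
  let v₀ , v₀∉X , v₀-leaf = complement-leaf X f ¬closed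
      zeros∈X = downX x₀ (zeros n) x₀∈X (zeros-≤c x₀)
      h , conj , nonAsc = nonAscending-conjugate X f downX zeros∈X (complement-avoids X rich) v₀∉X v₀-leaf
  in h , nonAscending⇒robustlyConverging downX nonAsc , conjugateFixing⇒similarX conj
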